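{- Let $S$ be a finite commutative semiring, $(X,M,h,\rho,\lambda)$ a BiM and $(f,m)\in S_M\times M$. Let $\Lambda_1(f,m)\colon\mathrm{Cl}(\widehat SX)\to\mathrm{Cl}(\widehat SX\times X)$ be the homomorphism given on generators by $$[K,k]\mapsto\bigcup_{k_1+k_2=k}\Big([m^{ -1}K,k_1]\times\Lambda_{12}(f,m)[K,k_2]\Big),\qquad \Lambda_{12}(f,m)[K,k']=\bigcup_{\substack{I\subseteq\mathrm{Sup}(f)\\ \sum_{n\in I}f(n)=k'}}\Big(\bigcap_{n\in I}n^{ -1}K\cap\bigcap_{n\in\mathrm{Sup}(f)\setminus I}n^{ -1}(X\setminus K)\Big).$$ Then $\Lambda_1(f,m)$ is dual to the continuous map $\lambda_1(f,m)\colon\widehat SX\times X\to\widehat SX$, $(\mu,x)\mapsto m\mu+\int fx$; that is, $\Lambda_1(f,m)[K,k]=\lambda_1(f,m)^{ -1}([K,k])$ for all $K\in\mathrm{Cl}(X)$, $k\in S$.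
   Context: Boolean space: compact Hausdorff with a basis of clopens; $\mathrm{Cl}(X)$ its clopens. A BiM is $(X,M,h,\rho,\lambda)$: $X$ Boolean space, $M$ monoid, $h\colon M\to X$ with dense image, $\rho,\lambda\colon M\to C(X,X)$ with $\rho(m)(h(n))=h(nm)$, $\lambda(m)(h(n))=h(mn)$; write $nx=\lambda(n)(x)$ and $n^{ -1}K=\{x:nx\in K\}$. An $S$-valued measure on $X$ is $\mu\colon\mathrm{Cl}(X)\to S$, $\mu(\emptyset)=0$, additive on disjoint clopens; $\widehat SX$ is the Boolean space of measures with topology generated by $[K,k]=\{\mu:\mu(K)=k\}$, with pointwise addition of measures. For $m\in M$, $(m\mu)(K)=\mu(m^{ -1}K)$. $S_M$ is the set of finitely supported $f\colon M\to S$, $\mathrm{Sup}(f)=\{n:f(n)\ne0\}$; $(\int fx)(K)=\sum_{n\in M,\,nx\in K}f(n)$. $\mathrm{Cl}(\widehat SX\times X)$ is the coproduct of $\mathrm{Cl}(\widehat SX)$ and $\mathrm{Cl}(X)$. -}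

module Defs where

open import Level using (0ℓ)
open import Data.Unit using (⊤)
open import Data.Empty using (⊥)
open import Data.Bool using (Bool; true; false; if_then_else_; _∨_)
open import Data.Product using (Σ; ∃; ∃₂; _×_; _,_; proj₁; proj₂)
open import Data.List using (List; []; _∷_; length; lookup)
open import Data.Fin using (Fin)
open import Data.Nat using (ℕ)
open import Relation.Nullary using (¬_)
open import Relation.Binary.PropositionalEquality using (_≡_; _≢_)
open import Function.Bundles using (_⇔_)
open import Algebra.Bundles using (CommutativeSemiring)
open import Algebra.Structures using (IsMonoid)
open import Data.List.Relation.Unary.Unique.Propositional using (Unique)
open import Data.List.Membership.Propositional using (_∈_)

record Topology (X : Set) : Set₁ where
  field
    Open      : (X → Set) → Set
    open-ext  : ∀ {U V : X → Set} → Open U → (∀ x → U x ⇔ V x) → Open V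
    open-univ : Open (λ _ → ⊤)
    open-∩    : ∀ {U V : X → Set} → Open U → Open V → Open (λ x → U x × V x)
    open-⋃    : (I : Set) (U : I → X → Set) → (∀ i → Open (U i)) →
                Open (λ x → ∃ λ i → U i x)

module _ {X : Set} (T : Topology X) where
  open Topology T

  Compact : Set₁
  Compact = (I : Set) (U : I → X → Set) → (∀ i → Open (U i)) →
            (∀ x → ∃ λ i → U i x) →
            ∃ λ (is : List I) → ∀ x → ∃ λ i → i ∈ is × U i x

  Hausdorff : Set₁
  Hausdorff = ∀ x y → x ≢ y → ∃₂ λ (U V : X → Set) →
              Open U × Open V × U x × V y × (∀ z → U z → V z → ⊥)

  IsClopen : (X → Bool) → Set
  IsClopen K = Open (λ x → K x ≡ true) × Open (λ x → K x ≡ false)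

  ClopenBasis : Set₁
  ClopenBasis = ∀ (U : X → Set) → Open U → ∀ x → U x →
                ∃ λ (K : X → Bool) → IsClopen K × K x ≡ true ×
                  (∀ z → K z ≡ true → U z)

record BooleanSpace : Set₁ where
  field
    Pt        : Set
    topology  : Topology Pt
    compact   : Compact topology
    hausdorff : Hausdorff topology
    basis     : ClopenBasis topology
  open Topology topology public

module _ (X : BooleanSpace) where
  open BooleanSpace X

  Continuous : (Pt → Pt) → Set₁
  Continuous f = ∀ (U : Pt → Set) → Open U → Open (λ x → U (f x))

  record Clopen : Set where
    constructor clopen
    field
      char      : Pt → Bool
      isClopen  : IsClopen topology char
  open Clopen public

record BiM (X : BooleanSpace) : Set₁ where
  open BooleanSpace X
  field
    M        : Set
    _∙_      : M → M → M
    ε        : M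
    isMonoid : IsMonoid _≡_ _∙_ ε
    h        : M → Pt
    dense    : ∀ (U : Pt → Set) → Open U → (∃ λ x → U x) → ∃ λ n → U (h n)
    rho      : M → Pt → Pt
    lam      : M → Pt → Pt
    rho-cont : ∀ m → Continuous X (rho m)
    lam-cont : ∀ m → Continuous X (lam m)
    rho-h    : ∀ m n → rho m (h n) ≡ h (n ∙ m)
    lam-h    : ∀ m n → lam m (h n) ≡ h (m ∙ n)

  _⁻¹·_ : M → Clopen X → Clopen X
  n ⁻¹· K = clopen (λ x → char K (lam n x))
                   ( lam-cont n _ (proj₁ (isClopen K))
                   , lam-cont n _ (proj₂ (isClopen K)) )

module _ (S : CommutativeSemiring 0ℓ 0ℓ) where
  open CommutativeSemiring S

  IsFinite : Set
  IsFinite = ∃ λ (n : ℕ) → Σ (Fin n → Carrier) λ e → ∀ s → ∃ λ i → e i ≈ s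

  sumFin : ∀ n → (Fin n → Carrier) → Carrier
  sumFin ℕ.zero    g = 0#
  sumFin (ℕ.suc n) g = g Fin.zero + sumFin n (λ i → g (Fin.suc i))

  module _ (X : BooleanSpace) where
    open BooleanSpace X

    Disjoint : Clopen X → Clopen X → Set
    Disjoint K L = ∀ x → char K x ≡ true → char L x ≡ true → ⊥

    record Measure : Set where
      field
        μ     : Clopen X → Carrier
        μ-ext : ∀ K L → (∀ x → char K x ≡ char L x) → μ K ≈ μ L
        μ-∅   : ∀ K → (∀ x → char K x ≡ false) → μ K ≈ 0#
        μ-add : ∀ K L J → Disjoint K L →
                (∀ x → char J x ≡ (char K x ∨ char L x)) →
                μ J ≈ μ K + μ L
    open Measure public

    module _ (B : BiM X) where
      open BiM B

      record FinSupp : Set where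
        field
          fun      : M → Carrier
          supp     : List M
          unique   : Unique supp
          supp-spec : ∀ n → (n ∈ supp) ⇔ (¬ (fun n ≈ 0#))
      open FinSupp public

      sumList : List M → (M → Carrier) → Carrier
      sumList []       g = 0#
      sumList (n ∷ ns) g = g n + sumList ns g

      -- (∫ f x)(K) = Σ_{n ∈ M, n x ∈ K} f(n)   (only n ∈ Sup(f) contribute)
      ∫ : FinSupp → Pt → Clopen X → Carrier
      ∫ f x K = sumList (supp f)
                  (λ n → if char K (lam n x) then fun f n else 0#)

      λ₁ : FinSupp → M → Measure → Pt → Clopen X → Carrier
      λ₁ f m ν x K = μ ν (m ⁻¹· K) + ∫ f x K

      -- membership of x in Λ₁₂(f,m)[K,k']; a subset I ⊆ Sup(f) is given by
      -- a Boolean on each position of the (repetition-free) list Sup(f)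
      InΛ₁₂ : FinSupp → Clopen X → Carrier → Pt → Set
      InΛ₁₂ f K k' x =
        ∃ λ (I : Fin (length (supp f)) → Bool) →
          sumFin (length (supp f))
                 (λ i → if I i then fun f (lookup (supp f) i) else 0#) ≈ k'
          × (∀ i → I i ≡ true  → char K (lam (lookup (supp f) i) x) ≡ true)
          × (∀ i → I i ≡ false → char K (lam (lookup (supp f) i) x) ≡ false)

      InΛ₁ : FinSupp → M → Clopen X → Carrier → Measure → Pt → Set
      InΛ₁ f m K k ν x =
        ∃₂ λ k₁ k₂ → (k₁ + k₂ ≈ k) × (μ ν (m ⁻¹· K) ≈ k₁) × InΛ₁₂ f K k₂ x

-- 1. Duality of Λ₁₂.  A point x lies in the piece of Λ₁₂(f,m)[K,k'] indexed by
--    I ⊆ Sup(f) exactly when I = {n ∈ Sup(f) : nx ∈ K}; the membership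
--    conditions pin I down uniquely.  For that I, Σ_{n∈I} f(n) is (∫fx)(K), so
--    x ∈ Λ₁₂(f,m)[K,k'] iff (∫fx)(K) = k'  (lemma Λ₁₂-dual).
-- 2. Splitting a sum.  In any semiring, a + b ≈ k iff k splits as k₁ + k₂
--    with a ≈ k₁ and b ≈ k₂  (lemma sum-splits).  With a = μ(m⁻¹K) and
--    b = (∫fx)(K), this is the union over k₁ + k₂ = k defining Λ₁(f,m)[K,k].
--
-- Finiteness of S is only needed to make these unions finite (so that Λ₁ is a
-- map into clopens); the pointwise identity holds for any semiring.
module Submission where

open import Level using (0ℓ)
open import Function.Bundles using (_⇔_; mk⇔; Equivalence)
open import Algebra.Bundles using (CommutativeSemiring)
open import Defs
open import Data.Bool using (Bool; true; false; if_then_else_)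
open import Data.Nat using (zero; suc)
open import Data.Fin using (Fin)
open import Data.List using (List; []; _∷_; length; lookup)
open import Data.Product using (∃₂; _×_; _,_)
open import Relation.Binary.PropositionalEquality as P using (_≡_; refl)

-- A Boolean is determined by the two implications b ≡ true → c ≡ true and
-- b ≡ false → c ≡ false; this is why the subset I in Λ₁₂ is unique.
bool-determined : (b c : Bool) → (b ≡ true → c ≡ true) →
                  (b ≡ false → c ≡ false) → b ≡ c
bool-determined true  c onTrue onFalse = P.sym (onTrue refl)
bool-determined false c onTrue onFalse = P.sym (onFalse refl)

module _ (S : CommutativeSemiring 0ℓ 0ℓ) where
  open CommutativeSemiring S renaming (refl to ≈-refl)

  sum-splits : (a b k : Carrier) →
               (∃₂ λ k₁ k₂ → (k₁ + k₂ ≈ k) × (a ≈ k₁) × (b ≈ k₂)) ⇔ (a + b ≈ k)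
  sum-splits a b k = mk⇔
    (λ (k₁ , k₂ , k₁+k₂≈k , a≈k₁ , b≈k₂) → trans (+-cong a≈k₁ b≈k₂) k₁+k₂≈k)
    (λ a+b≈k → a , b , a+b≈k , ≈-refl , ≈-refl)

  sumFin-cong : ∀ n (g g' : Fin n → Carrier) → (∀ i → g i ≡ g' i) →
                sumFin S n g ≡ sumFin S n g'
  sumFin-cong zero    g g' g≡g' = refl
  sumFin-cong (suc n) g g' g≡g' =
    P.cong₂ _+_ (g≡g' Fin.zero)
                (sumFin-cong n (λ i → g (Fin.suc i)) (λ i → g' (Fin.suc i))
                               (λ i → g≡g' (Fin.suc i)))

  module _ (X : BooleanSpace) (B : BiM X) where
    open BooleanSpace X using (Pt)
    open BiM B

    sumFin-lookup : (ns : List M) (g : M → Carrier) →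
                    sumFin S (length ns) (λ i → g (lookup ns i)) ≡ sumList S X B ns g
    sumFin-lookup []       g = refl
    sumFin-lookup (n ∷ ns) g = P.cong (g n +_) (sumFin-lookup ns g)

    module _ (f : FinSupp S X B) (K : Clopen X) (x : Pt) where
      private
        ns = supp f
        len = length ns

      hits : Fin len → Bool
      hits i = char K (lam (lookup ns i) x)

      weight : (Fin len → Bool) → Carrier
      weight I = sumFin S len (λ i → if I i then fun f (lookup ns i) else 0#)

      weight-hits : weight hits ≡ ∫ S X B f x K
      weight-hits = sumFin-lookup ns
                      (λ n → if char K (lam n x) then fun f n else 0#)

      -- Any subset satisfying the membership conditions of Λ₁₂ is the hit set,
      -- hence has weight (∫fx)(K).
      weight-unique : (I : Fin len → Bool) →
                      (∀ i → I i ≡ true  → hits i ≡ true) →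
                      (∀ i → I i ≡ false → hits i ≡ false) →
                      weight I ≡ ∫ S X B f x K
      weight-unique I inK notInK = P.trans
        (sumFin-cong len _ _ λ i →
           P.cong (λ b → if b then fun f (lookup ns i) else 0#)
                  (bool-determined (I i) (hits i) (inK i) (notInK i)))
        weight-hits

      Λ₁₂-dual : (k' : Carrier) → InΛ₁₂ S X B f K k' x ⇔ (∫ S X B f x K ≈ k')
      Λ₁₂-dual k' = mk⇔
        (λ (I , weightI≈k' , inK , notInK) →
           trans (reflexive (P.sym (weight-unique I inK notInK))) weightI≈k')
        (λ ∫≈k' → hits , trans (reflexive weight-hits) ∫≈k'
                       , (λ i hit → hit) , (λ i miss → miss))

-- Membership in Λ₁(f,m)[K,k] is the split form of sum-splits for
-- μ(m⁻¹K) + (∫fx)(K), with the Λ₁₂ factor replaced by its dual condition.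
lemma6p8 : (S : CommutativeSemiring 0ℓ 0ℓ) → IsFinite S →
    (X : BooleanSpace) (B : BiM X) →
    (f : FinSupp S X B) (m : BiM.M B) (K : Clopen X)
    (k : CommutativeSemiring.Carrier S)
    (ν : Measure S X) (x : BooleanSpace.Pt X) →
    InΛ₁ S X B f m K k ν x ⇔
    CommutativeSemiring._≈_ S (λ₁ S X B f m ν x K) k
lemma6p8 S _ X B f m K k ν x = mk⇔
  (λ (k₁ , k₂ , split , μ≈k₁ , inΛ₁₂) →
     to (k₁ , k₂ , split , μ≈k₁ , Equivalence.to (Λ₁₂-dual S X B f K x k₂) inΛ₁₂))
  (λ λ₁≈k → let (k₁ , k₂ , split , μ≈k₁ , ∫≈k₂) = from λ₁≈k
            in k₁ , k₂ , split , μ≈k₁ , Equivalence.from (Λ₁₂-dual S X B f K x k₂) ∫≈k₂)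
  where
    open Equivalence (sum-splits S (μ ν (BiM._⁻¹·_ B m K)) (∫ S X B f x K) k)
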